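{- Let $\mathsf{w}$ be a contracted reduced expression for a maximally clustered permutation $w \in S_n$, so $\mathsf{w}$ has the form $a_0 c_1 a_1 \cdots c_M a_M$ where each $c_j$ is a braid cluster and the $a_j$ are short-braid avoiding. Then any generator $s_i$ that appears in any of the braid clusters $c_j$ does not appear anywhere else in $\mathsf{w}$ (i.e. in no factor of $\mathsf{w}$ other than $c_j$).
   Context: $S_n$ is the Coxeter group with generators $s_1,\dots,s_{n-1}$ (adjacent transpositions $s_i$ swapping the entries in positions $i,i+1$ of the 1-line notation). A permutation $w=[w_1\cdots w_n]$ contains the pattern $p=[p_1\cdots p_k]\in S_k$ if there are indices $i_1<\dots<i_k$ with $w_{i_a}<w_{i_b}$ iff $p_a<p_b$ for all $a<b$; each such index tuple is a pattern instance. $N(w)$ is the number of instances of the pattern $[321]$ in $w$. A short-braid is a factor $s_is_{i\pm1}s_i$; an expression is short-braid avoiding if it has no such consecutive factor. A braid cluster is an expression $s_{i_1} \cdots s_{i_k} s_{i_{k+1}} s_{i_k} \cdots s_{i_1}$ where each $s_{i_p}$, $1\le p\le k$, has a unique $s_{i_q}$ with $p<q\le k+1$ and $|i_p-i_q|=1$. A permutation $w$ is maximally clustered if it has a reduced expression of the form $a_0 c_1 a_1 c_2 a_2\cdots c_M a_M$ where each $a_i$ is a reduced expression, each $c_i$ is a braid cluster of length $2n_i+1$, and $N(w)=\sum_{i=1}^M n_i$; such an expression is called contracted. -}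

module Defs where

open import Data.Nat using (ℕ; zero; suc; _+_; _≤_; _<_; _<?_; ∣_-_∣)
open import Data.Nat.Properties using (_≟_)
open import Data.List using (List; []; _∷_; _++_; _∷ʳ_; reverse; length; filter; map; foldl; upTo; lookup)
open import Data.Nat.ListAction using (sum)
open import Data.List.Relation.Unary.All using (All)
open import Data.List.Membership.Propositional using (_∈_)
open import Data.Product using (Σ; _×_; _,_)
open import Data.Unit using (⊤)
open import Data.Empty using (⊥)
open import Relation.Nullary using (¬_)
open import Relation.Binary.PropositionalEquality using (_≡_)

-- A word (expression) is a list of generator indices: i stands for s_i.

ValidWord : ℕ → List ℕ → Set
ValidWord n w = All (λ i → 1 ≤ i × suc i ≤ n) w

swapAt : ℕ → List ℕ → List ℕ
swapAt (suc zero) (x ∷ y ∷ xs) = y ∷ x ∷ xs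
swapAt (suc (suc k)) (x ∷ xs) = x ∷ swapAt (suc k) xs
swapAt _ xs = xs

idPerm : ℕ → List ℕ
idPerm n = map suc (upTo n)

-- one-line notation of the product s_{i1} s_{i2} ... s_{ik}:
-- right multiplication by s_i swaps the entries in positions i, i+1.
perm : ℕ → List ℕ → List ℕ
perm n w = foldl (λ v i → swapAt i v) (idPerm n) w

Reduced : ℕ → List ℕ → Set
Reduced n w = (v : List ℕ) → ValidWord n v → perm n v ≡ perm n w → length w ≤ length v

countBelow : ℕ → List ℕ → ℕ
countBelow y xs = length (filter (λ z → z <? y) xs)

count21Below : ℕ → List ℕ → ℕ
count21Below x [] = 0
count21Below x (y ∷ ys) with y <? x
... | Relation.Nullary.yes _ = countBelow y ys + count21Below x ys
... | Relation.Nullary.no _ = count21Below x ys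

N321 : List ℕ → ℕ
N321 [] = 0
N321 (x ∷ xs) = count21Below x xs + N321 xs

countAdj : ℕ → List ℕ → ℕ
countAdj x xs = length (filter (λ y → ∣ x - y ∣ ≟ 1) xs)

UniqueAdjLater : List ℕ → Set
UniqueAdjLater [] = ⊥
UniqueAdjLater (x ∷ []) = ⊤
UniqueAdjLater (x ∷ y ∷ ys) = countAdj x (y ∷ ys) ≡ 1 × UniqueAdjLater (y ∷ ys)

BraidCluster : List ℕ → ℕ → Set
BraidCluster c m =
  Σ (List ℕ) λ l → Σ ℕ λ mid →
    (c ≡ l ++ (mid ∷ reverse l)) × (length l ≡ m) × (1 ≤ m) × UniqueAdjLater (l ∷ʳ mid)

ShortBraidAvoiding : List ℕ → Set
ShortBraidAvoiding (x ∷ y ∷ z ∷ rest) =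
  ¬ (x ≡ z × ∣ x - y ∣ ≡ 1) × ShortBraidAvoiding (y ∷ z ∷ rest)
ShortBraidAvoiding _ = ⊤

-- A block (c_j , n_j , a_j).
Block : Set
Block = List ℕ × ℕ × List ℕ

cl : Block → List ℕ
cl (c , _ , _) = c

num : Block → ℕ
num (_ , m , _) = m

aft : Block → List ℕ
aft (_ , _ , a) = a

assemble : List ℕ → List Block → List ℕ
assemble a0 [] = a0
assemble a0 ((c , _ , a) ∷ bs) = a0 ++ (c ++ assemble a bs)

-- contracted reduced expression for the permutation it represents,
-- with short-braid avoiding factors a_j
ContractedSBA : ℕ → List ℕ → List Block → Set
ContractedSBA n a0 bs =
  ValidWord n (assemble a0 bs) ×
  Reduced n (assemble a0 bs) ×
  All (λ b → BraidCluster (cl b) (num b)) bs ×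
  (sum (map num bs) ≡ N321 (perm n (assemble a0 bs))) ×
  ShortBraidAvoiding a0 ×
  All (λ b → ShortBraidAvoiding (aft b)) bs

module Submission where

-- In a reduced word every letter is an ascent of the permutation it multiplies: a descent could be
-- cancelled against the earlier letter that created the inversion. Under this condition a braid
-- cluster s_{i₁}⋯s_{i_k} s_{i_{k+1}} s_{i_k}⋯s_{i₁} acts on one-line notation f as the transposition
-- of two positions p < q = p + k + 1, all of its letters lie in [p, q), and it inverts the k triples
-- of values f q > f z > f p with p < z < q. These are [321]-instances, and as a reduced word inverts
-- each pair of values at most once, different clusters give different instances; so the clusters
-- account for all N(w) instances. If a letter in [p, q) also occurred outside the cluster, the
-- occurrence nearest to the cluster would swap some f z with a neighbouring value outside every
-- cluster, creating one more [321]-instance.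

open import Defs
open import Data.Nat using (ℕ)
open import Data.List using (List; length; lookup)
open import Data.List.Membership.Propositional using (_∈_; _∉_)
open import Data.Fin using (Fin)
open import Data.Product using (_×_)
open import Relation.Binary.PropositionalEquality using (_≢_)

open import Data.Empty using (⊥)
open import Data.Unit using (⊤; tt)
open import Data.Fin using (zero; suc)
import Data.Fin as Fin
open import Data.List using ([]; _∷_; _++_; reverse; foldl; map; applyUpTo; concat; tabulate)
open import Data.List.Membership.Propositional.Properties
  using (∈-++⁻; ∈-++⁺ˡ; ∈-++⁺ʳ; ∈-map⁺; ∈-map⁻; ∈-∃++; ∈-concat⁻′; ∈-tabulate⁻; ∈-lookup; ∈-applyUpTo⁻)
open import Data.List.Properties
  using (length-++; ++-assoc; unfold-reverse; length-map; filter-accept; filter-reject; length-applyUpTo)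
open import Data.List.Relation.Unary.All as All using (All; []; _∷_)
open import Data.List.Relation.Unary.AllPairs using ([]; _∷_)
open import Data.List.Relation.Unary.Any using (here; there)
open import Data.List.Relation.Unary.Unique.Propositional using (Unique)
import Data.List.Relation.Unary.All.Properties as All
import Data.List.Relation.Unary.AllPairs.Properties as AllPairs
import Data.List.Relation.Unary.Unique.Propositional.Properties as Unique
open import Data.Nat
open import Data.Nat.ListAction using (sum)
open import Data.Nat.Properties
open import Data.Product using (Σ; _,_; proj₁; proj₂)
open import Data.Sum using (_⊎_; inj₁; inj₂; [_,_]′)
import Data.Sum as Sum
open import Function using (_∘_)
open import Relation.Binary.Definitions using (tri<; tri≈; tri>)
open import Relation.Binary.PropositionalEquality
open import Relation.Nullary

transpose : ℕ → ℕ → ℕ → ℕ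
transpose a b v with v ≟ a | v ≟ b
... | yes _ | _     = b
... | no _  | yes _ = a
... | no _  | no _  = v

transpose-left : ∀ a b → transpose a b a ≡ b
transpose-left a b with a ≟ a
... | yes _   = refl
... | no a≢a = contradiction refl a≢a

transpose-right : ∀ a b → a ≢ b → transpose a b b ≡ a
transpose-right a b a≢b with b ≟ a | b ≟ b
... | yes b≡a | _       = contradiction (sym b≡a) a≢b
... | no _    | yes _   = refl
... | no _    | no b≢b = contradiction refl b≢b

transpose-other : ∀ a b v → v ≢ a → v ≢ b → transpose a b v ≡ v
transpose-other a b v v≢a v≢b with v ≟ a | v ≟ b
... | yes v≡a | _       = contradiction v≡a v≢a
... | no _    | yes v≡b = contradiction v≡b v≢b
... | no _    | no _    = refl

data TransposeView (a b v : ℕ) : Set where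
  left  : v ≡ a → TransposeView a b v
  right : v ≡ b → TransposeView a b v
  other : v ≢ a → v ≢ b → TransposeView a b v

transposeView : ∀ a b v → TransposeView a b v
transposeView a b v with v ≟ a | v ≟ b
... | yes v≡a | _       = left v≡a
... | no _    | yes v≡b = right v≡b
... | no v≢a  | no v≢b  = other v≢a v≢b

transpose-comm : ∀ a b v → a ≢ b → transpose a b v ≡ transpose b a v
transpose-comm a b v a≢b with transposeView a b v
... | left refl  = trans (transpose-left v b) (sym (transpose-right b v (≢-sym a≢b)))
... | right refl = trans (transpose-right a v a≢b) (sym (transpose-left v a))
... | other v≢a v≢b = trans (transpose-other a b v v≢a v≢b) (sym (transpose-other b a v v≢b v≢a))

transpose-involutive : ∀ a b v → a ≢ b → transpose a b (transpose a b v) ≡ v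
transpose-involutive a b v a≢b with transposeView a b v
... | left refl rewrite transpose-left v b = transpose-right v b a≢b
... | right refl rewrite transpose-right a v a≢b = transpose-left a v
... | other v≢a v≢b rewrite transpose-other a b v v≢a v≢b = transpose-other a b v v≢a v≢b

swap : ℕ → ℕ → ℕ
swap x = transpose x (suc x)

x≢1+x : ∀ x → x ≢ suc x
x≢1+x x = ≢-sym 1+n≢n

swap-left : ∀ x → swap x x ≡ suc x
swap-left x = transpose-left x (suc x)

swap-right : ∀ x → swap x (suc x) ≡ x
swap-right x = transpose-right x (suc x) (x≢1+x x)

swap-other : ∀ x z → z ≢ x → z ≢ suc x → swap x z ≡ z
swap-other x = transpose-other x (suc x)

swap-involutive : ∀ x z → swap x (swap x z) ≡ z
swap-involutive x z = transpose-involutive x (suc x) z (x≢1+x x)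

SwapView : ℕ → ℕ → Set
SwapView x = TransposeView x (suc x)

swapView : ∀ x z → SwapView x z
swapView x = transposeView x (suc x)

swap-monotone : ∀ x {a b} → a < b → ¬ (a ≡ x × b ≡ suc x) → swap x a < swap x b
swap-monotone x {a} {b} a<b not-xy with swapView x a | swapView x b
... | left refl    | left refl    = contradiction a<b (<-irrefl refl)
... | left refl    | right refl   = contradiction (refl , refl) not-xy
... | left refl    | other _ b≢1+x =
  subst₂ _<_ (sym (swap-left a)) (sym (swap-other a b (>⇒≢ a<b) b≢1+x)) (≤∧≢⇒< a<b (≢-sym b≢1+x))
... | right refl   | left refl    = contradiction a<b (<-asym (n<1+n b))
... | right refl   | right refl   = contradiction a<b (<-irrefl refl)
... | right refl   | other b≢x b≢1+x =
  subst₂ _<_ (sym (swap-right x)) (sym (swap-other x b b≢x b≢1+x)) (<-trans (n<1+n x) a<b)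
... | other a≢x a≢1+x | left refl =
  subst₂ _<_ (sym (swap-other b a a≢x a≢1+x)) (sym (swap-left b)) (<-trans a<b (n<1+n b))
... | other a≢x a≢1+x | right refl =
  subst₂ _<_ (sym (swap-other x a a≢x a≢1+x)) (sym (swap-right x)) (≤∧≢⇒< (≤-pred a<b) a≢x)
... | other a≢x a≢1+x | other b≢x b≢1+x =
  subst₂ _<_ (sym (swap-other x a a≢x a≢1+x)) (sym (swap-other x b b≢x b≢1+x)) a<b

swap-bounded : ∀ {n} x z → 1 ≤ x → suc x ≤ n → 1 ≤ z → z ≤ n → 1 ≤ swap x z × swap x z ≤ n
swap-bounded x z 1≤x x<n 1≤z z≤N with swapView x z
... | left refl  = subst (λ y → 1 ≤ y × y ≤ _) (sym (swap-left z)) (s≤s z≤n , x<n)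
... | right refl = subst (λ y → 1 ≤ y × y ≤ _) (sym (swap-right x)) (1≤x , ≤-trans (n≤1+n x) x<n)
... | other z≢x z≢1+x = subst (λ y → 1 ≤ y × y ≤ _) (sym (swap-other x z z≢x z≢1+x)) (1≤z , z≤N)

swap-conj-transposeˡ : ∀ i q z → suc i < q → swap i (transpose (suc i) q (swap i z)) ≡ transpose i q z
swap-conj-transposeˡ i q z 1+i<q with swapView i z
... | left refl rewrite swap-left z | transpose-left (suc z) q =
  trans (swap-other z q (>⇒≢ (<-trans (n<1+n z) 1+i<q)) (>⇒≢ 1+i<q)) (sym (transpose-left z q))
... | right refl rewrite swap-right i | transpose-other (suc i) q i (<⇒≢ (n<1+n i)) (<⇒≢ (<-trans (n<1+n i) 1+i<q)) =
  trans (swap-left i) (sym (transpose-other i q (suc i) (>⇒≢ (n<1+n i)) (<⇒≢ 1+i<q)))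
... | other z≢i z≢1+i rewrite swap-other i z z≢i z≢1+i with transposeView (suc i) q z
...   | left z≡1+i = contradiction z≡1+i z≢1+i
...   | right refl rewrite transpose-right (suc i) z (<⇒≢ 1+i<q) =
  trans (swap-right i) (sym (transpose-right i z (<⇒≢ (<-trans (n<1+n i) 1+i<q))))
...   | other _ z≢q rewrite transpose-other (suc i) q z z≢1+i z≢q =
  trans (swap-other i z z≢i z≢1+i) (sym (transpose-other i q z z≢i z≢q))

swap-conj-transposeʳ : ∀ p q z → p < q → swap q (transpose p q (swap q z)) ≡ transpose p (suc q) z
swap-conj-transposeʳ p q z p<q with swapView q z
... | left refl rewrite swap-left z | transpose-other p z (suc z) (>⇒≢ (<-trans p<q (n<1+n z))) (>⇒≢ (n<1+n z)) =
  trans (swap-right z) (sym (transpose-other p (suc z) z (>⇒≢ p<q) (<⇒≢ (n<1+n z))))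
... | right refl rewrite swap-right q | transpose-right p q (<⇒≢ p<q) =
  trans (swap-other q p (<⇒≢ p<q) (<⇒≢ (<-trans p<q (n<1+n q)))) (sym (transpose-right p (suc q) (<⇒≢ (<-trans p<q (n<1+n q)))))
... | other z≢q z≢1+q rewrite swap-other q z z≢q z≢1+q with transposeView p q z
...   | left refl rewrite transpose-left z q = trans (swap-left q) (sym (transpose-left z (suc q)))
...   | right z≡q = contradiction z≡q z≢q
...   | other z≢p _ rewrite transpose-other p q z z≢p z≢q =
  trans (swap-other q z z≢q z≢1+q) (sym (transpose-other p (suc q) z z≢p z≢1+q))

relabel-swap : ∀ (F : ℕ → ℕ) x → (∀ {z z′} → F z ≡ F z′ → z ≡ z′) →
               ∀ z → F (swap x z) ≡ transpose (F x) (F (suc x)) (F z)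
relabel-swap F x F-inj z with swapView x z
... | left refl  = trans (cong F (swap-left z)) (sym (transpose-left (F z) (F (suc z))))
... | right refl = trans (cong F (swap-right x))
                         (sym (transpose-right (F x) (F (suc x)) (λ e → x≢1+x x (F-inj e))))
... | other z≢x z≢1+x = trans (cong F (swap-other x z z≢x z≢1+x))
      (sym (transpose-other (F x) (F (suc x)) (F z) (z≢x ∘ F-inj) (z≢1+x ∘ F-inj)))

letter : List ℕ → ℕ → ℕ
letter []      _       = 0
letter (x ∷ w) zero    = x
letter (x ∷ w) (suc t) = letter w t

-- entry w t is the one-line notation of the prefix s_{w₀} ⋯ s_{w_{t-1}} read as a map from
-- positions to values (both numbered from 1, the identity beyond n); place w t is its inverse.
entry : List ℕ → ℕ → ℕ → ℕ
entry w zero    z = z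
entry w (suc t) z = entry w t (swap (letter w t) z)

place : List ℕ → ℕ → ℕ → ℕ
place w zero    v = v
place w (suc t) v = swap (letter w t) (place w t v)

entry-place : ∀ w t v → entry w t (place w t v) ≡ v
entry-place w zero    v = refl
entry-place w (suc t) v rewrite swap-involutive (letter w t) (place w t v) = entry-place w t v

place-entry : ∀ w t z → place w t (entry w t z) ≡ z
place-entry w zero    z = refl
place-entry w (suc t) z rewrite place-entry w t (swap (letter w t) z) = swap-involutive (letter w t) z

entry-injective : ∀ w t {z z′} → entry w t z ≡ entry w t z′ → z ≡ z′
entry-injective w t {z} {z′} e = trans (sym (place-entry w t z)) (trans (cong (place w t) e) (place-entry w t z′))

letter-valid : ∀ {n} w t → ValidWord n w → t < length w → 1 ≤ letter w t × suc (letter w t) ≤ n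
letter-valid (x ∷ w) zero    (x-valid ∷ _) _        = x-valid
letter-valid (x ∷ w) (suc t) (_ ∷ w-valid) (s≤s t<) = letter-valid w t w-valid t<

entry-bounded : ∀ {n} w → ValidWord n w → ∀ t → t ≤ length w → ∀ z → 1 ≤ z → z ≤ n →
                1 ≤ entry w t z × entry w t z ≤ n
entry-bounded w valid zero    _  z 1≤z z≤N = 1≤z , z≤N
entry-bounded w valid (suc t) t< z 1≤z z≤N with letter-valid w t valid t<
... | 1≤x , x<n with swap-bounded (letter w t) z 1≤x x<n 1≤z z≤N
...   | 1≤z′ , z′≤n = entry-bounded w valid t (<⇒≤ t<) _ 1≤z′ z′≤n

place-bounded : ∀ {n} w → ValidWord n w → ∀ t → t ≤ length w → ∀ v → 1 ≤ v → v ≤ n →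
                1 ≤ place w t v × place w t v ≤ n
place-bounded w valid zero    _  v 1≤v v≤n = 1≤v , v≤n
place-bounded w valid (suc t) t< v 1≤v v≤n with place-bounded w valid t (<⇒≤ t<) v 1≤v v≤n | letter-valid w t valid t<
... | 1≤v′ , v′≤n | 1≤x , x<n = swap-bounded (letter w t) _ 1≤x x<n 1≤v′ v′≤n

act : (ℕ → ℕ) → List ℕ → ℕ → ℕ
act f []      = f
act f (x ∷ w) = act (f ∘ swap x) w

act-++ : ∀ f u v → act f (u ++ v) ≡ act (act f u) v
act-++ f []      v = refl
act-++ f (x ∷ u) v = act-++ (f ∘ swap x) u v

Ascents : (ℕ → ℕ) → List ℕ → Set
Ascents f []      = ⊤
Ascents f (x ∷ w) = f x < f (suc x) × Ascents (f ∘ swap x) w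

Ascents-++⁻ : ∀ f u v → Ascents f (u ++ v) → Ascents f u × Ascents (act f u) v
Ascents-++⁻ f []      v ascs         = tt , ascs
Ascents-++⁻ f (x ∷ u) v (asc , ascs) with Ascents-++⁻ (f ∘ swap x) u v ascs
... | ascs-u , ascs-v = (asc , ascs-u) , ascs-v

Ascending : List ℕ → Set
Ascending w = ∀ t → t < length w → entry w t (letter w t) < entry w t (suc (letter w t))

FactorAt : List ℕ → ℕ → List ℕ → Set
FactorAt w s u = (s + length u ≤ length w) × (∀ r → r < length u → letter w (s + r) ≡ letter u r)

FactorAt-∷⁻ : ∀ w s x u → FactorAt w s (x ∷ u) → letter w s ≡ x × FactorAt w (suc s) u
FactorAt-∷⁻ w s x u (fits , letters) =
  trans (cong (letter w) (sym (+-identityʳ s))) (letters 0 (s≤s z≤n)) ,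
  ≤-trans (≤-reflexive (sym (+-suc s (length u)))) fits ,
  λ r r< → trans (cong (letter w) (sym (+-suc s r))) (letters (suc r) (s≤s r<))

entry-factor : ∀ w s u → FactorAt w s u → ∀ z → entry w (s + length u) z ≡ act (entry w s) u z
entry-factor w s []      _ z = cong (λ t → entry w t z) (+-identityʳ s)
entry-factor w s (x ∷ u) f z with FactorAt-∷⁻ w s x u f
... | refl , f′ = trans (cong (λ t → entry w t z) (+-suc s (length u))) (entry-factor w (suc s) u f′ z)

ascents-factor : ∀ w s u → FactorAt w s u → Ascending w → Ascents (entry w s) u
ascents-factor w s []      _ _   = tt
ascents-factor w s (x ∷ u) f asc with FactorAt-∷⁻ w s x u f
... | refl , f′ = asc s (<-≤-trans (m<m+n s (s≤s z≤n)) (proj₁ f)) , ascents-factor w (suc s) u f′ asc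

-- Braid clusters act as transpositions

clusterWord : List ℕ → ℕ → List ℕ
clusterWord []      m = m ∷ []
clusterWord (i ∷ l) m = i ∷ (clusterWord l m ++ i ∷ [])

clusterWord-≡ : ∀ l m → l ++ m ∷ reverse l ≡ clusterWord l m
clusterWord-≡ []      m = refl
clusterWord-≡ (i ∷ l) m = cong (i ∷_) (begin
  l ++ m ∷ reverse (i ∷ l)          ≡⟨ cong (λ r → l ++ m ∷ r) (unfold-reverse i l) ⟩
  l ++ (m ∷ reverse l) ++ i ∷ []    ≡⟨ ++-assoc l (m ∷ reverse l) (i ∷ []) ⟨
  (l ++ m ∷ reverse l) ++ i ∷ []    ≡⟨ cong (_++ i ∷ []) (clusterWord-≡ l m) ⟩
  clusterWord l m ++ i ∷ []         ∎)
  where open ≡-Reasoning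

record ClusterAction (f : ℕ → ℕ) (l : List ℕ) (m : ℕ) : Set where
  field
    lo              : ℕ
    letters-bounded : ∀ x → x ∈ clusterWord l m → lo ≤ x × x ≤ length l + lo
    lo∈             : lo ∈ clusterWord l m
    top∈            : length l + lo ∈ clusterWord l m
    act≡transpose   : ∀ z → act f (clusterWord l m) z ≡ f (transpose lo (suc (length l + lo)) z)
    lo-min          : ∀ z → lo < z → z ≤ suc (length l + lo) → f lo < f z
    hi-max          : ∀ z → lo ≤ z → z < suc (length l + lo) → f z < f (suc (length l + lo))

module ClusterStep (f : ℕ → ℕ) (i : ℕ) (l : List ℕ) (m : ℕ) (asc-i : f i < f (suc i))
  (inner : ClusterAction (f ∘ swap i) l m)
  (asc-last : act (f ∘ swap i) (clusterWord l m) i < act (f ∘ swap i) (clusterWord l m) (suc i)) where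

  open ClusterAction inner renaming (lo to p; letters-bounded to letters-bounded′; lo∈ to p∈;
    top∈ to top∈′; act≡transpose to act≡transpose′; lo-min to p-min; hi-max to q-max)

  g : ℕ → ℕ
  g = f ∘ swap i

  K : ℕ
  K = length l

  q : ℕ
  q = suc (K + p)

  p<q : p < q
  p<q = s≤s (m≤n+m p K)

  asc-last′ : g (transpose p q i) < g (transpose p q (suc i))
  asc-last′ = subst₂ _<_ (act≡transpose′ i) (act≡transpose′ (suc i)) asc-last

  g≡f : ∀ z → z ≢ i → z ≢ suc i → g z ≡ f z
  g≡f z z≢i z≢1+i = cong f (swap-other i z z≢i z≢1+i)

  act-outer : ∀ z → act f (clusterWord (i ∷ l) m) z ≡ f (swap i (transpose p q (swap i z)))
  act-outer z = trans (cong (λ h → h z) (act-++ g (clusterWord l m) (i ∷ []))) (act≡transpose′ (swap i z))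

  -- The outer letter i must touch the pair {p, q} transposed by the inner cluster:
  -- otherwise one of the ascent conditions would force f (suc i) < f i.
  touches : suc i ≡ p ⊎ i ≡ q
  touches with suc i ≟ p | i ≟ q
  ... | yes 1+i≡p | _     = inj₁ 1+i≡p
  ... | no _      | yes i≡q = inj₂ i≡q
  ... | no 1+i≢p  | no i≢q  = contradiction asc-i (<-asym descent)
    where
    descent : f (suc i) < f i
    descent with i ≟ p | suc i ≟ q
    ... | yes refl | _ = subst₂ _<_ (cong f (swap-left i)) (cong f (swap-right i)) (p-min (suc i) (n<1+n i) p<q)
    ... | no _ | yes 1+i≡q =
      subst₂ _<_ (cong f (swap-left i)) (trans (cong g (sym 1+i≡q)) (cong f (swap-right i)))
             (q-max i (≤-pred (subst (p <_) (sym 1+i≡q) p<q)) (subst (i <_) 1+i≡q (n<1+n i)))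
    ... | no i≢p | no 1+i≢q =
      subst₂ _<_ (trans (cong g (transpose-other p q i i≢p i≢q)) (cong f (swap-left i)))
                 (trans (cong g (transpose-other p q (suc i) 1+i≢p 1+i≢q)) (cong f (swap-right i))) asc-last′

  extend-below : suc i ≡ p → ClusterAction f (i ∷ l) m
  extend-below 1+i≡p = record
    { lo              = i
    ; letters-bounded = bounded
    ; lo∈             = here refl
    ; top∈            = subst (_∈ clusterWord (i ∷ l) m) K+p≡top (there (∈-++⁺ˡ top∈′))
    ; act≡transpose   = λ z → trans (act-outer z) (cong f (begin
        swap i (transpose p q (swap i z))        ≡⟨ cong (λ u → swap i (transpose u q (swap i z))) (sym 1+i≡p) ⟩
        swap i (transpose (suc i) q (swap i z))  ≡⟨ swap-conj-transposeˡ i q z 1+i<q ⟩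
        transpose i q z                          ≡⟨ cong (λ u → transpose i u z) q≡1+top ⟩
        transpose i (suc (suc K + i)) z          ∎))
    ; lo-min          = lo-min
    ; hi-max          = hi-max
    }
    where
    open ≡-Reasoning
    K+p≡top : K + p ≡ suc K + i
    K+p≡top = trans (cong (K +_) (sym 1+i≡p)) (+-suc K i)
    q≡1+top : q ≡ suc (suc K + i)
    q≡1+top = cong suc K+p≡top
    1+i<q : suc i < q
    1+i<q = subst (_< q) (sym 1+i≡p) p<q
    i<q : i < q
    i<q = <-trans (n<1+n i) 1+i<q
    g-p : g p ≡ f i
    g-p = trans (cong g (sym 1+i≡p)) (cong f (swap-right i))
    g-q : g q ≡ f q
    g-q = g≡f q (>⇒≢ i<q) (>⇒≢ 1+i<q)
    bounded : ∀ x → x ∈ clusterWord (i ∷ l) m → i ≤ x × x ≤ suc K + i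
    bounded x (here refl) = ≤-refl , m≤n+m i (suc K)
    bounded x (there x∈) with ∈-++⁻ (clusterWord l m) x∈
    ... | inj₁ x∈′ = let (p≤x , x≤top) = letters-bounded′ x x∈′ in
      <⇒≤ (subst (_≤ x) (sym 1+i≡p) p≤x) , ≤-trans x≤top (≤-reflexive K+p≡top)
    ... | inj₂ (here refl) = ≤-refl , m≤n+m i (suc K)
    lo-min : ∀ z → i < z → z ≤ suc (suc K + i) → f i < f z
    lo-min z i<z z≤ with m≤n⇒m<n∨m≡n i<z
    ... | inj₂ refl = asc-i
    ... | inj₁ 1+i<z = subst₂ _<_ g-p (g≡f z (>⇒≢ (<-trans (n<1+n i) 1+i<z)) (>⇒≢ 1+i<z))
                         (p-min z (subst (_< z) 1+i≡p 1+i<z) (subst (z ≤_) (sym q≡1+top) z≤))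
    hi-max : ∀ z → i ≤ z → z < suc (suc K + i) → f z < f (suc (suc K + i))
    hi-max z i≤z z< with m≤n⇒m<n∨m≡n i≤z
    ... | inj₂ refl = subst (λ u → f i < f u) q≡1+top (subst₂ _<_ g-p g-q (p-min q p<q ≤-refl))
    ... | inj₁ i<z with m≤n⇒m<n∨m≡n i<z
    ...   | inj₂ refl = subst (λ u → f (suc i) < f u) q≡1+top (subst₂ _<_
            (trans (cong g (transpose-other p q i (<⇒≢ (subst (i <_) 1+i≡p (n<1+n i))) (<⇒≢ i<q))) (cong f (swap-left i)))
            (trans (cong g (trans (cong (transpose p q) 1+i≡p) (transpose-left p q))) g-q) asc-last′)
    ...   | inj₁ 1+i<z = subst (λ u → f z < f u) q≡1+top (subst₂ _<_
            (g≡f z (>⇒≢ (<-trans (n<1+n i) 1+i<z)) (>⇒≢ 1+i<z)) g-q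
            (q-max z (subst (_≤ z) 1+i≡p (<⇒≤ 1+i<z)) (subst (z <_) (sym q≡1+top) z<)))

  extend-above : i ≡ q → ClusterAction f (i ∷ l) m
  extend-above i≡q = record
    { lo              = p
    ; letters-bounded = bounded
    ; lo∈             = there (∈-++⁺ˡ p∈)
    ; top∈            = subst (_∈ clusterWord (i ∷ l) m) i≡q (here refl)
    ; act≡transpose   = λ z → trans (act-outer z) (cong f (trans
        (cong (λ u → swap u (transpose p q (swap u z))) i≡q) (swap-conj-transposeʳ p q z p<q)))
    ; lo-min          = lo-min
    ; hi-max          = hi-max
    }
    where
    p<i : p < i
    p<i = subst (p <_) (sym i≡q) p<q
    outside : ∀ {z} → z < q → z ≢ i × z ≢ suc i
    outside z<q = (λ z≡i → <⇒≢ z<q (trans z≡i i≡q)) , (λ z≡1+i → <⇒≢ (<-trans z<q (n<1+n q)) (trans z≡1+i (cong suc i≡q)))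
    g-p : g p ≡ f p
    g-p = g≡f p (<⇒≢ p<i) (<⇒≢ (<-trans p<i (n<1+n i)))
    g-q : g q ≡ f (suc q)
    g-q = trans (cong g (sym i≡q)) (trans (cong f (swap-left i)) (cong (f ∘ suc) i≡q))
    bounded : ∀ x → x ∈ clusterWord (i ∷ l) m → p ≤ x × x ≤ suc K + p
    bounded x (here refl) = <⇒≤ p<i , ≤-reflexive i≡q
    bounded x (there x∈) with ∈-++⁻ (clusterWord l m) x∈
    ... | inj₁ x∈′ = let (p≤x , x≤top) = letters-bounded′ x x∈′ in p≤x , ≤-trans x≤top (n≤1+n _)
    ... | inj₂ (here refl) = <⇒≤ p<i , ≤-reflexive i≡q
    lo-min : ∀ z → p < z → z ≤ suc (suc K + p) → f p < f z
    lo-min z p<z z≤ with m≤n⇒m<n∨m≡n z≤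
    ... | inj₂ refl = subst₂ _<_ g-p g-q (p-min q p<q ≤-refl)
    ... | inj₁ z<1+q with m≤n⇒m<n∨m≡n (≤-pred z<1+q)
    ...   | inj₂ refl = subst₂ _<_
            (trans (cong g (trans (cong (transpose p q) i≡q) (transpose-right p q (<⇒≢ p<q)))) g-p)
            (trans (cong g (transpose-other p q (suc i) (>⇒≢ (<-trans p<i (n<1+n i))) (λ e → >⇒≢ (n<1+n i) (trans e (sym i≡q)))))
                   (trans (cong f (swap-right i)) (cong f i≡q)))
            asc-last′
    ...   | inj₁ z<q = subst₂ _<_ g-p (g≡f z (proj₁ (outside z<q)) (proj₂ (outside z<q))) (p-min z p<z (<⇒≤ z<q))
    hi-max : ∀ z → p ≤ z → z < suc (suc K + p) → f z < f (suc (suc K + p))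
    hi-max z p≤z z< with m≤n⇒m<n∨m≡n (≤-pred z<)
    ... | inj₂ refl = subst₂ _<_ (cong f i≡q) (cong (f ∘ suc) i≡q) asc-i
    ... | inj₁ z<q = subst₂ _<_ (g≡f z (proj₁ (outside z<q)) (proj₂ (outside z<q))) g-q (q-max z p≤z z<q)

cluster-action : ∀ f l m → Ascents f (clusterWord l m) → ClusterAction f l m
cluster-action f [] m (asc , _) = record
  { lo              = m
  ; letters-bounded = λ { x (here refl) → ≤-refl , ≤-refl }
  ; lo∈             = here refl
  ; top∈            = here refl
  ; act≡transpose   = λ z → refl
  ; lo-min          = λ z m<z z≤ → subst (λ u → f m < f u) (≤-antisym m<z z≤) asc
  ; hi-max          = λ z m≤z z< → subst (λ u → f u < f (suc m)) (≤-antisym m≤z (≤-pred z<)) asc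
  }
cluster-action f (i ∷ l) m (asc-i , ascs) with Ascents-++⁻ (f ∘ swap i) (clusterWord l m) (i ∷ []) ascs
... | ascs-inner , (asc-last , _) = [ extend-below , extend-above ]′ touches
  where open ClusterStep f i l m asc-i (cluster-action (f ∘ swap i) l m ascs-inner) asc-last

inversion-step : ∀ w t {a b} → Ascending w → t < length w → b < a →
                 place w t a < place w t b → place w (suc t) a < place w (suc t) b
inversion-step w t {a} {b} asc t< b<a inv = swap-monotone (letter w t) inv not-this-pair
  where
  not-this-pair : ¬ (place w t a ≡ letter w t × place w t b ≡ suc (letter w t))
  not-this-pair (a-here , b-next) = <-asym b<a (subst₂ _<_
    (trans (cong (entry w t) (sym a-here)) (entry-place w t a))
    (trans (cong (entry w t) (sym b-next)) (entry-place w t b)) (asc t t<))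

inversion-persists : ∀ w {a b} → Ascending w → b < a → ∀ {t} t′ → t ≤ t′ → t′ ≤ length w →
                     place w t a < place w t b → place w t′ a < place w t′ b
inversion-persists w asc b<a zero     z≤n _ inv = inv
inversion-persists w asc b<a (suc t′) t≤ t′< inv with m≤n⇒m<n∨m≡n t≤
... | inj₂ refl = inv
... | inj₁ t<1+t′ =
  inversion-step w t′ asc t′< b<a (inversion-persists w asc b<a t′ (≤-pred t<1+t′) (<⇒≤ t′<) inv)

InvertedBetween : List ℕ → ℕ → ℕ → ℕ → ℕ → Set
InvertedBetween w a b s e = (place w s b < place w s a) × (place w e a < place w e b)

inverted-once : ∀ w {a b} s₁ e₁ s₂ e₂ → Ascending w → b < a →
                InvertedBetween w a b s₁ e₁ → InvertedBetween w a b s₂ e₂ → e₁ ≤ s₂ → s₂ ≤ length w → ⊥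
inverted-once w s₁ e₁ s₂ e₂ asc b<a (_ , inv₁) (upright₂ , _) e₁≤s₂ s₂≤ =
  <-asym (inversion-persists w asc b<a _ e₁≤s₂ s₂≤ inv₁) upright₂

crossing : ∀ w a b d s → place w s b < place w s a → place w (d + s) a < place w (d + s) b →
           Σ ℕ λ u → s ≤ u × u < d + s × place w u b ≡ letter w u × place w u a ≡ suc (letter w u)
crossing w a b zero    s upright inv = contradiction inv (<-asym upright)
crossing w a b (suc d) s upright inv with place w s b ≟ letter w s ×-dec place w s a ≟ suc (letter w s)
... | yes here-now = s , ≤-refl , s≤s (m≤n+m s d) , here-now
... | no not-now with crossing w a b d (suc s) (swap-monotone (letter w s) upright not-now)
                                       (subst (λ t → place w t a < place w t b) (sym (+-suc d s)) inv)
...   | u , s<u , u< , crossed = u , <⇒≤ s<u , subst (u <_) (+-suc d s) u< , crossed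

valuesFrom : (ℕ → ℕ) → ℕ → ℕ → List ℕ
valuesFrom f o zero    = []
valuesFrom f o (suc m) = f o ∷ valuesFrom f (suc o) m

valuesFrom-cong : ∀ f g o m → (∀ z → o ≤ z → f z ≡ g z) → valuesFrom f o m ≡ valuesFrom g o m
valuesFrom-cong f g o zero    f≗g = refl
valuesFrom-cong f g o (suc m) f≗g =
  cong₂ _∷_ (f≗g o ≤-refl) (valuesFrom-cong f g (suc o) m (λ z o<z → f≗g z (<⇒≤ o<z)))

swapAt-valuesFrom : ∀ k f o m → suc (suc k) ≤ m → swapAt (suc k) (valuesFrom f o m) ≡ valuesFrom (f ∘ swap (k + o)) o m
swapAt-valuesFrom zero f o (suc (suc m)) _ =
  cong₂ _∷_ (cong f (sym (swap-left o))) (cong₂ _∷_ (cong f (sym (swap-right o)))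
    (valuesFrom-cong f _ (suc (suc o)) m
      (λ z 2+o≤z → cong f (sym (swap-other o z (>⇒≢ (<-trans (n<1+n o) 2+o≤z)) (>⇒≢ 2+o≤z))))))
swapAt-valuesFrom zero f o (suc zero) (s≤s ())
swapAt-valuesFrom (suc k) f o (suc m) (s≤s k<m) =
  cong₂ _∷_ (cong f (sym (swap-other (suc k + o) o (<⇒≢ (s≤s (m≤n+m o k))) (<⇒≢ (s≤s (≤-trans (m≤n+m o k) (n≤1+n _)))))))
    (trans (swapAt-valuesFrom k f (suc o) m k<m)
           (valuesFrom-cong _ _ (suc o) m (λ z _ → cong (λ u → f (swap u z)) (+-suc k o))))

foldl-swapAt-valuesFrom : ∀ n w f → ValidWord n w →
                          foldl (λ v i → swapAt i v) (valuesFrom f 1 n) w ≡ valuesFrom (act f w) 1 n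
foldl-swapAt-valuesFrom n []            f _ = refl
foldl-swapAt-valuesFrom n (zero  ∷ w)   f ((() , _) ∷ _)
foldl-swapAt-valuesFrom n (suc k ∷ w)   f ((_ , k<n) ∷ valid) =
  trans (cong (λ vs → foldl (λ v i → swapAt i v) vs w)
          (trans (swapAt-valuesFrom k f 1 n k<n) (valuesFrom-cong _ _ 1 n (λ z _ → cong (λ u → f (swap u z)) (+-comm k 1)))))
        (foldl-swapAt-valuesFrom n w (f ∘ swap (suc k)) valid)

applyUpTo-valuesFrom : ∀ m g o → (∀ r → g r ≡ r + o) → map suc (applyUpTo g m) ≡ valuesFrom (λ z → z) (suc o) m
applyUpTo-valuesFrom zero    g o g≗ = refl
applyUpTo-valuesFrom (suc m) g o g≗ = cong₂ _∷_ (cong suc (g≗ 0))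
  (applyUpTo-valuesFrom m (g ∘ suc) (suc o) (λ r → trans (g≗ (suc r)) (sym (+-suc r o))))

perm-entries : ∀ n w → ValidWord n w → perm n w ≡ valuesFrom (entry w (length w)) 1 n
perm-entries n w valid = begin
  foldl (λ v i → swapAt i v) (idPerm n) w                 ≡⟨ cong (λ vs → foldl (λ v i → swapAt i v) vs w)
                                                               (applyUpTo-valuesFrom n (λ z → z) 0 (λ r → sym (+-identityʳ r))) ⟩
  foldl (λ v i → swapAt i v) (valuesFrom (λ z → z) 1 n) w ≡⟨ foldl-swapAt-valuesFrom n w (λ z → z) valid ⟩
  valuesFrom (act (λ z → z) w) 1 n                        ≡⟨ valuesFrom-cong _ _ 1 n (λ z _ → sym (entry-factor w 0 w whole z)) ⟩
  valuesFrom (entry w (length w)) 1 n                     ∎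
  where
  open ≡-Reasoning
  whole : FactorAt w 0 w
  whole = ≤-refl , λ r _ → refl

-- Reduced words are ascending

deleteAt : ℕ → List ℕ → List ℕ
deleteAt _       []      = []
deleteAt zero    (x ∷ w) = w
deleteAt (suc k) (x ∷ w) = x ∷ deleteAt k w

All-deleteAt : ∀ {P : ℕ → Set} k w → All P w → All P (deleteAt k w)
All-deleteAt k       []      ps       = ps
All-deleteAt zero    (x ∷ w) (_ ∷ ps) = ps
All-deleteAt (suc k) (x ∷ w) (p ∷ ps) = p ∷ All-deleteAt k w ps

letter-deleteAt-< : ∀ k w r → r < k → letter (deleteAt k w) r ≡ letter w r
letter-deleteAt-< k       []      r       _        = refl
letter-deleteAt-< (suc k) (x ∷ w) zero    _        = refl
letter-deleteAt-< (suc k) (x ∷ w) (suc r) (s≤s r<k) = letter-deleteAt-< k w r r<k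

letter-deleteAt-≥ : ∀ k w r → k ≤ r → letter (deleteAt k w) r ≡ letter w (suc r)
letter-deleteAt-≥ k       []      r       _         = refl
letter-deleteAt-≥ zero    (x ∷ w) r       _         = refl
letter-deleteAt-≥ (suc k) (x ∷ w) (suc r) (s≤s k≤r) = letter-deleteAt-≥ k w r k≤r

length-deleteAt : ∀ k w → k < length w → suc (length (deleteAt k w)) ≡ length w
length-deleteAt zero    (x ∷ w) _         = refl
length-deleteAt (suc k) (x ∷ w) (s≤s k<) = cong suc (length-deleteAt k w k<)

-- If the letters at u < t swap the same pair of values {a, b}, the word with both letters
-- deleted represents the same permutation: the prefixes agree up to u, differ by the
-- transposition of a and b strictly between u and t, and agree again after t.
module Deletion (w : List ℕ) (u t a b : ℕ) (u<t : u < t) (t< : t < length w)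
  (u-swaps-b : entry w u (letter w u) ≡ b) (u-swaps-a : entry w u (suc (letter w u)) ≡ a)
  (t-swaps-a : entry w t (letter w t) ≡ a) (t-swaps-b : entry w t (suc (letter w t)) ≡ b) where

  w′ : List ℕ
  w′ = deleteAt u (deleteAt t w)

  b≢a : b ≢ a
  b≢a b≡a = x≢1+x (letter w u) (entry-injective w u (trans u-swaps-b (trans b≡a (sym u-swaps-a))))

  letter-w′-< : ∀ r → r < u → letter w′ r ≡ letter w r
  letter-w′-< r r<u = trans (letter-deleteAt-< u (deleteAt t w) r r<u) (letter-deleteAt-< t w r (<-trans r<u u<t))

  letter-w′-mid : ∀ r → u ≤ r → suc r < t → letter w′ r ≡ letter w (suc r)
  letter-w′-mid r u≤r 1+r<t = trans (letter-deleteAt-≥ u (deleteAt t w) r u≤r) (letter-deleteAt-< t w (suc r) 1+r<t)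

  letter-w′-≥ : ∀ r → u ≤ r → t ≤ suc r → letter w′ r ≡ letter w (suc (suc r))
  letter-w′-≥ r u≤r t≤1+r = trans (letter-deleteAt-≥ u (deleteAt t w) r u≤r) (letter-deleteAt-≥ t w (suc r) t≤1+r)

  swap-at-u : ∀ z → entry w (suc u) z ≡ transpose b a (entry w u z)
  swap-at-u z = trans (relabel-swap (entry w u) (letter w u) (entry-injective w u) z)
                      (cong₂ (λ c d → transpose c d (entry w u z)) u-swaps-b u-swaps-a)

  swap-at-t : ∀ z → entry w (suc t) z ≡ transpose b a (entry w t z)
  swap-at-t z = trans (relabel-swap (entry w t) (letter w t) (entry-injective w t) z)
    (trans (cong₂ (λ c d → transpose c d (entry w t z)) t-swaps-a t-swaps-b) (transpose-comm a b (entry w t z) (≢-sym b≢a)))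

  entry-before : ∀ r → r ≤ u → ∀ z → entry w′ r z ≡ entry w r z
  entry-before zero    _   z = refl
  entry-before (suc r) r<u z = trans (entry-before r (<⇒≤ r<u) _) (cong (λ y → entry w r (swap y z)) (letter-w′-< r r<u))

  entry-between : ∀ d → d + u < t → ∀ z → entry w′ (d + u) z ≡ transpose b a (entry w (suc (d + u)) z)
  entry-between zero    _  z = trans (entry-before u ≤-refl z)
    (trans (sym (transpose-involutive b a (entry w u z) b≢a)) (cong (transpose b a) (sym (swap-at-u z))))
  entry-between (suc d) d+u<t z = trans (entry-between d (<-trans (n<1+n _) d+u<t) _)
    (cong (λ y → transpose b a (entry w (suc (d + u)) (swap y z))) (letter-w′-mid (d + u) (m≤n+m u d) d+u<t))

  t-1 : ℕ
  t-1 = pred t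

  t-1+1 : suc t-1 ≡ t
  t-1+1 = suc-pred t {{>-nonZero (≤-<-trans z≤n u<t)}}

  u≤t-1 : u ≤ t-1
  u≤t-1 = ≤-pred (subst (u <_) (sym t-1+1) u<t)

  entry-after : ∀ d z → entry w′ (d + t-1) z ≡ entry w (suc (suc (d + t-1))) z
  entry-after zero z =
    trans (subst (λ v → entry w′ v z ≡ transpose b a (entry w (suc v) z)) (m∸n+n≡m u≤t-1)
                 (entry-between (t-1 ∸ u) (subst (_< t) (sym (m∸n+n≡m u≤t-1)) (subst (t-1 <_) t-1+1 (n<1+n t-1))) z))
          (trans (cong (λ v → transpose b a (entry w v z)) t-1+1)
                 (trans (sym (swap-at-t z)) (cong (λ v → entry w (suc v) z) (sym t-1+1))))
  entry-after (suc d) z = trans (entry-after d _) (cong (λ y → entry w (suc (suc (d + t-1))) (swap y z))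
    (letter-w′-≥ (d + t-1) (≤-trans u≤t-1 (m≤n+m t-1 d)) (subst (_≤ suc (d + t-1)) t-1+1 (s≤s (m≤n+m t-1 d)))))

  length-w′ : suc (suc (length w′)) ≡ length w
  length-w′ = trans (cong suc (length-deleteAt u (deleteAt t w) (<-≤-trans u<t (≤-pred (subst (t <_) (sym length-t) t<)))))
                    length-t
    where
    length-t : suc (length (deleteAt t w)) ≡ length w
    length-t = length-deleteAt t w t<

  entry-end : ∀ z → entry w′ (length w′) z ≡ entry w (length w) z
  entry-end z = trans (subst (λ v → entry w′ v z ≡ entry w (suc (suc v)) z) (m∸n+n≡m t-1≤) (entry-after (length w′ ∸ t-1) z))
                      (cong (λ v → entry w v z) length-w′)
    where
    t-1≤ : t-1 ≤ length w′
    t-1≤ = ≤-pred (≤-pred (subst (_≤ suc (suc (length w′))) (sym (cong suc t-1+1)) (subst (t <_) (sym length-w′) t<)))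

  not-reduced : ∀ n → ValidWord n w → ¬ Reduced n w
  not-reduced n valid reduced = <-irrefl refl
    (≤-trans (s≤s (n≤1+n (length w′))) (≤-trans (≤-reflexive length-w′) (reduced w′ valid′ same-perm)))
    where
    valid′ : ValidWord n w′
    valid′ = All-deleteAt u (deleteAt t w) (All-deleteAt t w valid)
    same-perm : perm n w′ ≡ perm n w
    same-perm = trans (perm-entries n w′ valid′)
      (trans (valuesFrom-cong _ _ 1 n (λ z _ → entry-end z)) (sym (perm-entries n w valid)))

-- A descent at t swaps a pair of values a > b that is already inverted; the first letter u < t
-- that inverted it swaps the same pair, so both letters can be deleted.
descent⇒¬reduced : ∀ n w t → ValidWord n w → t < length w →
                   entry w t (suc (letter w t)) < entry w t (letter w t) → ¬ Reduced n w
descent⇒¬reduced n w t valid t< desc with crossing w a b t 0 desc inverted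
  where
  a b : ℕ
  a = entry w t (letter w t)
  b = entry w t (suc (letter w t))
  inverted : place w (t + 0) a < place w (t + 0) b
  inverted = subst₂ _<_ (sym (trans (cong (λ s → place w s a) (+-identityʳ t)) (place-entry w t _)))
                        (sym (trans (cong (λ s → place w s b) (+-identityʳ t)) (place-entry w t _))) (n<1+n _)
... | u , _ , u< , b-at-u , a-at-u =
  Deletion.not-reduced w u t _ _ (subst (u <_) (+-identityʳ t) u<) t<
    (trans (cong (entry w u) (sym b-at-u)) (entry-place w u _))
    (trans (cong (entry w u) (sym a-at-u)) (entry-place w u _)) refl refl n valid

reduced⇒ascending : ∀ n w → ValidWord n w → Reduced n w → Ascending w
reduced⇒ascending n w valid reduced t t< with <-cmp (entry w t (letter w t)) (entry w t (suc (letter w t)))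
... | tri< asc _ _  = asc
... | tri≈ _ eq _   = contradiction (entry-injective w t eq) (x≢1+x (letter w t))
... | tri> _ _ desc = contradiction reduced (descent⇒¬reduced n w t valid t< desc)

-- Counting [321]-instances

indicesBelow : ℕ → ℕ → List ℕ → List ℕ
indicesBelow y o []       = []
indicesBelow y o (z ∷ zs) with z <? y
... | yes _ = o ∷ indicesBelow y (suc o) zs
... | no _  = indicesBelow y (suc o) zs

length-indicesBelow : ∀ y o zs → length (indicesBelow y o zs) ≡ countBelow y zs
length-indicesBelow y o []       = refl
length-indicesBelow y o (z ∷ zs) with z <? y
... | yes z<y = trans (cong suc (length-indicesBelow y (suc o) zs)) (cong length (sym (filter-accept (_<? y) z<y)))
... | no z≮y  = trans (length-indicesBelow y (suc o) zs) (cong length (sym (filter-reject (_<? y) z≮y)))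

pairs21 : ℕ → ℕ → List ℕ → List (ℕ × ℕ)
pairs21 x o []       = []
pairs21 x o (y ∷ ys) with y <? x
... | yes _ = map (o ,_) (indicesBelow y (suc o) ys) ++ pairs21 x (suc o) ys
... | no _  = pairs21 x (suc o) ys

length-pairs21 : ∀ x o ys → length (pairs21 x o ys) ≡ count21Below x ys
length-pairs21 x o []       = refl
length-pairs21 x o (y ∷ ys) with y <? x
... | yes _ = trans (length-++ (map (o ,_) (indicesBelow y (suc o) ys)))
                    (cong₂ _+_ (trans (length-map _ (indicesBelow y (suc o) ys)) (length-indicesBelow y (suc o) ys))
                               (length-pairs21 x (suc o) ys))
... | no _  = length-pairs21 x (suc o) ys

triples321 : ℕ → List ℕ → List (ℕ × ℕ × ℕ)
triples321 o []       = []
triples321 o (x ∷ xs) = map (o ,_) (pairs21 x (suc o) xs) ++ triples321 (suc o) xs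

length-triples321 : ∀ o xs → length (triples321 o xs) ≡ N321 xs
length-triples321 o []       = refl
length-triples321 o (x ∷ xs) = trans (length-++ (map (o ,_) (pairs21 x (suc o) xs)))
  (cong₂ _+_ (trans (length-map _ (pairs21 x (suc o) xs)) (length-pairs21 x (suc o) xs)) (length-triples321 (suc o) xs))

next-index : ∀ {k o m} → k < suc m + o → k ≢ o → o ≤ k → suc o ≤ k × k < m + suc o
next-index {k} {o} {m} k< k≢o o≤k = ≤∧≢⇒< o≤k (≢-sym k≢o) , subst (k <_) (sym (+-suc m o)) k<

∈-indicesBelow : ∀ F y o m k → o ≤ k → k < m + o → F k < y → k ∈ indicesBelow y o (valuesFrom F o m)
∈-indicesBelow F y o zero    k o≤k k< _ = contradiction (≤-<-trans o≤k k<) (<-irrefl refl)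
∈-indicesBelow F y o (suc m) k o≤k k< Fk<y with F o <? y | k ≟ o
... | yes _   | yes refl = here refl
... | yes _   | no k≢o   = let (o<k , k<′) = next-index k< k≢o o≤k in there (∈-indicesBelow F y (suc o) m k o<k k<′ Fk<y)
... | no Fo≮y | yes refl = contradiction Fk<y Fo≮y
... | no _    | no k≢o   = let (o<k , k<′) = next-index k< k≢o o≤k in ∈-indicesBelow F y (suc o) m k o<k k<′ Fk<y

∈-pairs21 : ∀ F x o m j k → o ≤ j → j < k → k < m + o → F j < x → F k < F j → (j , k) ∈ pairs21 x o (valuesFrom F o m)
∈-pairs21 F x o zero    j k o≤j j<k k< _ _ = contradiction (≤-<-trans o≤j (<-trans j<k k<)) (<-irrefl refl)
∈-pairs21 F x o (suc m) j k o≤j j<k k< Fj<x Fk<Fj with F o <? x | j ≟ o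
... | yes _   | yes refl = ∈-++⁺ˡ (∈-map⁺ (j ,_) (∈-indicesBelow F (F j) (suc j) m k j<k (subst (k <_) (sym (+-suc m j)) k<) Fk<Fj))
... | yes _   | no j≢o   = let (o<j , _) = next-index (<-trans j<k k<) j≢o o≤j in
  ∈-++⁺ʳ (map (o ,_) (indicesBelow (F o) (suc o) (valuesFrom F (suc o) m)))
         (∈-pairs21 F x (suc o) m j k o<j j<k (subst (k <_) (sym (+-suc m o)) k<) Fj<x Fk<Fj)
... | no Fo≮x | yes refl = contradiction Fj<x Fo≮x
... | no _    | no j≢o   = let (o<j , _) = next-index (<-trans j<k k<) j≢o o≤j in
  ∈-pairs21 F x (suc o) m j k o<j j<k (subst (k <_) (sym (+-suc m o)) k<) Fj<x Fk<Fj

∈-triples321 : ∀ F o m i j k → o ≤ i → i < j → j < k → k < m + o → F j < F i → F k < F j →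
               (i , j , k) ∈ triples321 o (valuesFrom F o m)
∈-triples321 F o zero    i j k o≤i i<j j<k k< _ _ = contradiction (≤-<-trans o≤i (<-trans i<j (<-trans j<k k<))) (<-irrefl refl)
∈-triples321 F o (suc m) i j k o≤i i<j j<k k< Fj<Fi Fk<Fj with i ≟ o
... | yes refl = ∈-++⁺ˡ (∈-map⁺ (i ,_) (∈-pairs21 F (F i) (suc i) m j k i<j j<k (subst (k <_) (sym (+-suc m i)) k<) Fj<Fi Fk<Fj))
... | no i≢o   = let (o<i , _) = next-index (<-trans i<j (<-trans j<k k<)) i≢o o≤i in
  ∈-++⁺ʳ (map (o ,_) (pairs21 (F o) (suc o) (valuesFrom F (suc o) m)))
         (∈-triples321 F (suc o) m i j k o<i i<j j<k (subst (k <_) (sym (+-suc m o)) k<) Fj<Fi Fk<Fj)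

unique-⊆⇒length≤ : ∀ {A : Set} (xs ys : List A) → Unique xs → (∀ {v} → v ∈ xs → v ∈ ys) → length xs ≤ length ys
unique-⊆⇒length≤ []       ys _              _    = z≤n
unique-⊆⇒length≤ (x ∷ xs) ys (x∉xs ∷ unique) xs⊆ys with ∈-∃++ (xs⊆ys (here refl))
... | ys₁ , ys₂ , refl = subst (suc (length xs) ≤_) (sym (trans (length-++ ys₁) (+-suc (length ys₁) (length ys₂))))
      (s≤s (subst (length xs ≤_) (length-++ ys₁) (unique-⊆⇒length≤ xs (ys₁ ++ ys₂) unique xs⊆ys₁++ys₂)))
  where
  xs⊆ys₁++ys₂ : ∀ {v} → v ∈ xs → v ∈ ys₁ ++ ys₂
  xs⊆ys₁++ys₂ v∈xs with ∈-++⁻ ys₁ (xs⊆ys (there v∈xs))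
  ... | inj₁ v∈ys₁        = ∈-++⁺ˡ v∈ys₁
  ... | inj₂ (here v≡x)   = contradiction (sym v≡x) (All.lookup x∉xs v∈xs)
  ... | inj₂ (there v∈ys₂) = ∈-++⁺ʳ ys₁ v∈ys₂

-- A [321]-instance of the permutation represented by w, recorded by its values a > b > c.
Instance321 : List ℕ → ℕ → ℕ × ℕ × ℕ → Set
Instance321 w n (a , b , c) =
  b < a × c < b × 1 ≤ place w (length w) a × place w (length w) a < place w (length w) b ×
  place w (length w) b < place w (length w) c × place w (length w) c ≤ n

instances≤N321 : ∀ n w (T : List (ℕ × ℕ × ℕ)) → ValidWord n w → Unique T → (∀ {τ} → τ ∈ T → Instance321 w n τ) →
                 length T ≤ N321 (perm n w)
instances≤N321 n w T valid unique instances =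
  subst₂ _≤_ (length-map positions T) (trans (length-triples321 1 (valuesFrom E 1 n)) (cong N321 (sym (perm-entries n w valid))))
    (unique-⊆⇒length≤ (map positions T) (triples321 1 (valuesFrom E 1 n)) (Unique.map⁺ positions-injective unique) ⊆triples)
  where
  P E : ℕ → ℕ
  P = place w (length w)
  E = entry w (length w)
  positions : ℕ × ℕ × ℕ → ℕ × ℕ × ℕ
  positions (a , b , c) = (P a , P b , P c)
  P-injective : ∀ {a a′} → P a ≡ P a′ → a ≡ a′
  P-injective {a} {a′} e = trans (sym (entry-place w (length w) a)) (trans (cong E e) (entry-place w (length w) a′))
  positions-injective : ∀ {x y} → positions x ≡ positions y → x ≡ y
  positions-injective e with P-injective (cong proj₁ e) | P-injective (cong (proj₁ ∘ proj₂) e) | P-injective (cong (proj₂ ∘ proj₂) e)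
  ... | refl | refl | refl = refl
  ⊆triples : ∀ {v} → v ∈ map positions T → v ∈ triples321 1 (valuesFrom E 1 n)
  ⊆triples v∈ with ∈-map⁻ positions v∈
  ... | (a , b , c) , τ∈ , refl with instances τ∈
  ... | b<a , c<b , 1≤Pa , Pa<Pb , Pb<Pc , Pc≤n =
    ∈-triples321 E 1 n (P a) (P b) (P c) 1≤Pa Pa<Pb Pb<Pc (subst (P c <_) (+-comm 1 n) (s≤s Pc≤n))
      (subst₂ _<_ (sym (entry-place w (length w) b)) (sym (entry-place w (length w) a)) b<a)
      (subst₂ _<_ (sym (entry-place w (length w) c)) (sym (entry-place w (length w) b)) c<b)

letter-++ʳ : ∀ u v r → letter (u ++ v) (length u + r) ≡ letter v r
letter-++ʳ []      v r = refl
letter-++ʳ (x ∷ u) v r = letter-++ʳ u v r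

letter-++ˡ : ∀ u v r → r < length u → letter (u ++ v) r ≡ letter u r
letter-++ˡ (x ∷ u) v zero    _        = refl
letter-++ˡ (x ∷ u) v (suc r) (s≤s r<) = letter-++ˡ u v r r<

FactorAt-prefix : ∀ u v → FactorAt (u ++ v) 0 u
FactorAt-prefix u v = subst (length u ≤_) (sym (length-++ u)) (m≤m+n _ _) , λ r r< → letter-++ˡ u v r r<

FactorAt-shift : ∀ p v s u → FactorAt v s u → FactorAt (p ++ v) (length p + s) u
FactorAt-shift p v s u (fits , letters) =
  subst (_≤ length (p ++ v)) (sym (+-assoc (length p) s (length u)))
        (subst (length p + (s + length u) ≤_) (sym (length-++ p)) (+-monoʳ-≤ (length p) fits)) ,
  λ r r< → trans (cong (letter (p ++ v)) (+-assoc (length p) s r)) (trans (letter-++ʳ p v (s + r)) (letters r r<))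

FactorAt-∈ : ∀ w s u i → FactorAt w s u → i ∈ u → Σ ℕ λ r → r < length u × letter w (s + r) ≡ i
FactorAt-∈ w s (x ∷ u) i f (here refl) = 0 , s≤s z≤n , proj₂ f 0 (s≤s z≤n)
FactorAt-∈ w s (x ∷ u) i f (there i∈u) with FactorAt-∈ w (suc s) u i (proj₂ (FactorAt-∷⁻ w s x u f)) i∈u
... | r , r< , at-r = suc r , s≤s r< , trans (cong (letter w) (+-suc s r)) at-r

a₀-factor : ∀ a bs → FactorAt (assemble a bs) 0 a
a₀-factor a []                  = ≤-refl , λ r _ → refl
a₀-factor a ((c , m , a′) ∷ bs) = FactorAt-prefix a _

clusterStart : (a₀ : List ℕ) (bs : List Block) → Fin (length bs) → ℕ
clusterStart a₀ ((c , m , a) ∷ bs) zero    = length a₀ + 0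
clusterStart a₀ ((c , m , a) ∷ bs) (suc j) = length a₀ + (length c + clusterStart a bs j)

afterStart : (a₀ : List ℕ) (bs : List Block) → Fin (length bs) → ℕ
afterStart a₀ ((c , m , a) ∷ bs) zero    = length a₀ + (length c + 0)
afterStart a₀ ((c , m , a) ∷ bs) (suc j) = length a₀ + (length c + afterStart a bs j)

cluster-factor : ∀ a₀ bs j → FactorAt (assemble a₀ bs) (clusterStart a₀ bs j) (cl (lookup bs j))
cluster-factor a₀ ((c , m , a) ∷ bs) zero    = FactorAt-shift a₀ _ 0 c (FactorAt-prefix c _)
cluster-factor a₀ ((c , m , a) ∷ bs) (suc j) = FactorAt-shift a₀ _ _ (cl (lookup bs j)) (FactorAt-shift c _ _ (cl (lookup bs j)) (cluster-factor a bs j))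

after-factor : ∀ a₀ bs j → FactorAt (assemble a₀ bs) (afterStart a₀ bs j) (aft (lookup bs j))
after-factor a₀ ((c , m , a) ∷ bs) zero    = FactorAt-shift a₀ _ _ a (FactorAt-shift c _ 0 a (a₀-factor a bs))
after-factor a₀ ((c , m , a) ∷ bs) (suc j) = FactorAt-shift a₀ _ _ (aft (lookup bs j)) (FactorAt-shift c _ _ (aft (lookup bs j)) (after-factor a bs j))

shift-≤ : ∀ p x l y → x + l ≤ y → (p + x) + l ≤ p + y
shift-≤ p x l y x+l≤y = subst (_≤ p + y) (sym (+-assoc p x l)) (+-monoʳ-≤ p x+l≤y)

a₀≤clusterStart : ∀ a₀ bs j → length a₀ ≤ clusterStart a₀ bs j
a₀≤clusterStart a₀ (_ ∷ bs) zero    = m≤m+n _ _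
a₀≤clusterStart a₀ (_ ∷ bs) (suc j) = m≤m+n _ _

clusters-disjoint : ∀ a₀ bs j j′ → j ≢ j′ →
  (clusterStart a₀ bs j + length (cl (lookup bs j)) ≤ clusterStart a₀ bs j′) ⊎
  (clusterStart a₀ bs j′ + length (cl (lookup bs j′)) ≤ clusterStart a₀ bs j)
clusters-disjoint a₀ ((c , m , a) ∷ bs) zero    zero     j≢j′ = contradiction refl j≢j′
clusters-disjoint a₀ ((c , m , a) ∷ bs) zero    (suc j′) _    = inj₁ (shift-≤ (length a₀) 0 (length c) _ (m≤m+n _ _))
clusters-disjoint a₀ ((c , m , a) ∷ bs) (suc j) zero     _    = inj₂ (shift-≤ (length a₀) 0 (length c) _ (m≤m+n _ _))
clusters-disjoint a₀ ((c , m , a) ∷ bs) (suc j) (suc j′) j≢j′ with clusters-disjoint a bs j j′ (j≢j′ ∘ cong suc)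
... | inj₁ j-first  = inj₁ (shift-≤ (length a₀) _ _ _ (shift-≤ (length c) _ _ _ j-first))
... | inj₂ j′-first = inj₂ (shift-≤ (length a₀) _ _ _ (shift-≤ (length c) _ _ _ j′-first))

cluster-after-disjoint : ∀ a₀ bs j k →
  (afterStart a₀ bs k + length (aft (lookup bs k)) ≤ clusterStart a₀ bs j) ⊎
  (clusterStart a₀ bs j + length (cl (lookup bs j)) ≤ afterStart a₀ bs k)
cluster-after-disjoint a₀ ((c , m , a) ∷ bs) zero    zero    = inj₂ (shift-≤ (length a₀) 0 (length c) _ (≤-reflexive (sym (+-identityʳ _))))
cluster-after-disjoint a₀ ((c , m , a) ∷ bs) zero    (suc k) = inj₂ (shift-≤ (length a₀) 0 (length c) _ (m≤m+n _ _))
cluster-after-disjoint a₀ ((c , m , a) ∷ bs) (suc j) zero    =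
  inj₁ (shift-≤ (length a₀) _ _ _ (shift-≤ (length c) 0 (length a) _ (a₀≤clusterStart a bs j)))
cluster-after-disjoint a₀ ((c , m , a) ∷ bs) (suc j) (suc k) with cluster-after-disjoint a bs j k
... | inj₁ k-first = inj₁ (shift-≤ (length a₀) _ _ _ (shift-≤ (length c) _ _ _ k-first))
... | inj₂ j-first = inj₂ (shift-≤ (length a₀) _ _ _ (shift-≤ (length c) _ _ _ j-first))

length-concat : ∀ {A : Set} (xss : List (List A)) → length (concat xss) ≡ sum (map length xss)
length-concat []         = refl
length-concat (xs ∷ xss) = trans (length-++ xs) (cong (length xs +_) (length-concat xss))

sum-length-tabulate : ∀ (bs : List Block) (T : Fin (length bs) → List (ℕ × ℕ × ℕ)) →
                      (∀ j → length (T j) ≡ num (lookup bs j)) → sum (map length (tabulate T)) ≡ sum (map num bs)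
sum-length-tabulate []       T length-T = refl
sum-length-tabulate (b ∷ bs) T length-T = cong₂ _+_ (length-T zero) (sum-length-tabulate bs (T ∘ suc) (length-T ∘ suc))

TripleInvertedBetween : List ℕ → ℕ → ℕ → ℕ × ℕ × ℕ → Set
TripleInvertedBetween w s e (a , b , c) = InvertedBetween w a b s e × InvertedBetween w a c s e × InvertedBetween w b c s e

record ClusterShape (b : Block) : Set where
  field
    outer          : List ℕ
    middle         : ℕ
    cl≡clusterWord : cl b ≡ clusterWord outer middle
    length-outer   : length outer ≡ num b
    1≤num          : 1 ≤ num b

clusterShape : ∀ b → BraidCluster (cl b) (num b) → ClusterShape b
clusterShape b (l , mid , cl≡ , length-l , 1≤m , _) = record
  { outer = l ; middle = mid ; cl≡clusterWord = trans cl≡ (clusterWord-≡ l mid) ; length-outer = length-l ; 1≤num = 1≤m }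

module Contracted (n : ℕ) (a₀ : List ℕ) (bs : List Block) (valid : ValidWord n (assemble a₀ bs))
  (asc : Ascending (assemble a₀ bs)) (clusters : All (λ b → BraidCluster (cl b) (num b)) bs) where

  w : List ℕ
  w = assemble a₀ bs

  L : ℕ
  L = length w

  instance321 : ∀ a b c t₁ t₂ → t₁ ≤ L → t₂ ≤ L → b < a → c < b →
                place w t₁ a < place w t₁ b → place w t₂ b < place w t₂ c →
                1 ≤ a → a ≤ n → 1 ≤ c → c ≤ n → Instance321 w n (a , b , c)
  instance321 a b c t₁ t₂ t₁≤ t₂≤ b<a c<b inv₁ inv₂ 1≤a a≤n 1≤c c≤n =
    b<a , c<b , proj₁ (place-bounded w valid L ≤-refl a 1≤a a≤n) ,
    inversion-persists w asc b<a L t₁≤ ≤-refl inv₁ , inversion-persists w asc c<b L t₂≤ ≤-refl inv₂ ,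
    proj₂ (place-bounded w valid L ≤-refl c 1≤c c≤n)

  inverted-in-one-window : ∀ a b s e s′ e′ → b < a → InvertedBetween w a b s e → InvertedBetween w a b s′ e′ →
                           (e ≤ s′ × s′ ≤ L) ⊎ (e′ ≤ s × s ≤ L) → ⊥
  inverted-in-one-window a b s e s′ e′ b<a inv inv′ (inj₁ (e≤s′ , s′≤)) = inverted-once w s e s′ e′ asc b<a inv inv′ e≤s′ s′≤
  inverted-in-one-window a b s e s′ e′ b<a inv inv′ (inj₂ (e′≤s , s≤))  = inverted-once w s′ e′ s e asc b<a inv′ inv e′≤s s≤

  -- Opaque so that the type checker does not unfold this proof inside every term mentioning a window.
  opaque
    shape : (j : Fin (length bs)) → ClusterShape (lookup bs j)
    shape j = clusterShape (lookup bs j) (All.lookup clusters (∈-lookup j))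

  module Window (j : Fin (length bs)) where
    open ClusterShape (shape j) public

    s : ℕ
    s = clusterStart a₀ bs j

    c : List ℕ
    c = clusterWord outer middle

    factor : FactorAt w s c
    factor = subst (FactorAt w s) cl≡clusterWord (cluster-factor a₀ bs j)

    f : ℕ → ℕ
    f = entry w s

    open ClusterAction (cluster-action f outer middle (ascents-factor w s c factor asc)) public renaming (lo to p)

    K : ℕ
    K = length outer

    q : ℕ
    q = suc (K + p)

    e : ℕ
    e = s + length c

    e≡ : e ≡ clusterStart a₀ bs j + length (cl (lookup bs j))
    e≡ = cong (λ x → s + length x) (sym cl≡clusterWord)

    e≤L : e ≤ L
    e≤L = proj₁ factor

    s≤L : s ≤ L
    s≤L = ≤-trans (m≤m+n s _) e≤L

    entry-e : ∀ z → entry w e z ≡ f (transpose p q z)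
    entry-e z = trans (entry-factor w s c factor z) (act≡transpose z)

    p<q : p < q
    p<q = s≤s (m≤n+m p K)

    1+p<q : suc p < q
    1+p<q = s≤s (+-monoˡ-≤ p (subst (1 ≤_) (sym length-outer) 1≤num))

    letter-valid-c : ∀ x → x ∈ c → 1 ≤ x × suc x ≤ n
    letter-valid-c x x∈ with FactorAt-∈ w s c x factor x∈
    ... | r , r< , refl = letter-valid w (s + r) valid (<-≤-trans (+-monoʳ-< s r<) e≤L)

    f-bounded : ∀ z → p ≤ z → z ≤ q → 1 ≤ f z × f z ≤ n
    f-bounded z p≤z z≤q = entry-bounded w valid s s≤L z (≤-trans (proj₁ (letter-valid-c p lo∈)) p≤z)
                                                   (≤-trans z≤q (proj₂ (letter-valid-c (K + p) top∈)))

    place-e : ∀ z → place w e (f (transpose p q z)) ≡ z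
    place-e z = trans (cong (place w e) (sym (entry-e z))) (place-entry w e z)

    triple : ℕ → ℕ × ℕ × ℕ
    triple z = f q , f z , f p

    triple-inverted : ∀ z → p < z → z < q → TripleInvertedBetween w s e (triple z)
    triple-inverted z p<z z<q =
      (upright z<q , inverted (transpose-right p q (<⇒≢ p<q)) (transpose-other p q z (>⇒≢ p<z) (<⇒≢ z<q)) p<z) ,
      (upright p<q , inverted (transpose-right p q (<⇒≢ p<q)) (transpose-left p q) p<q) ,
      (upright p<z , inverted (transpose-other p q z (>⇒≢ p<z) (<⇒≢ z<q)) (transpose-left p q) z<q)
      where
      upright : ∀ {y y′} → y < y′ → place w s (f y) < place w s (f y′)
      upright = subst₂ _<_ (sym (place-entry w s _)) (sym (place-entry w s _))
      inverted : ∀ {y y′ x x′} → transpose p q y ≡ x → transpose p q y′ ≡ x′ → x < x′ → place w e (f y) < place w e (f y′)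
      inverted refl refl = subst₂ _<_ (sym (trans (cong (place w e ∘ f) (sym (transpose-involutive p q _ (<⇒≢ p<q)))) (place-e _)))
                                      (sym (trans (cong (place w e ∘ f) (sym (transpose-involutive p q _ (<⇒≢ p<q)))) (place-e _)))

    InRange : ℕ → Set
    InRange x = p ≤ x × x < q

    inRange? : ∀ x → Dec (InRange x)
    inRange? x = p ≤? x ×-dec x <? q

    swap-fixes-interior : ∀ x z → ¬ InRange x → p < z → z < q → swap x z ≡ z
    swap-fixes-interior x z out p<z z<q = swap-other x z
      (λ z≡x → out (subst (p ≤_) z≡x (<⇒≤ p<z) , subst (_< q) z≡x z<q))
      (λ z≡1+x → out (≤-pred (subst (p <_) z≡1+x p<z) , <-trans (subst (x <_) (sym z≡1+x) (n<1+n x)) z<q))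

    Undisturbed : ℕ → Set
    Undisturbed t = ∀ z → p < z → z < q → entry w t z ≡ f z

    record Disturbance : Set where
      field
        t*    : ℕ
        t*<L  : t* < L
        apart : (e ≤ t* × t* ≤ L) ⊎ (suc t* ≤ s × s ≤ L)
        z     : ℕ
        p<z   : p < z
        z<q   : z < q
        moves : f z ≡ entry w t* (letter w t*) ⊎ f z ≡ entry w t* (suc (letter w t*))

    instances : List (ℕ × ℕ × ℕ)
    instances = applyUpTo (λ r → triple (suc r + p)) K

    ∈-instances⁻ : ∀ {τ} → τ ∈ instances → Σ ℕ λ z → p < z × z < q × τ ≡ triple z
    ∈-instances⁻ τ∈ with ∈-applyUpTo⁻ (λ r → triple (suc r + p)) τ∈
    ... | r , r<K , τ≡ = suc r + p , s≤s (m≤n+m p r) , s≤s (+-monoˡ-< p r<K) , τ≡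

    length-instances : length instances ≡ num (lookup bs j)
    length-instances = trans (length-applyUpTo _ K) length-outer

    instances-unique : Unique instances
    instances-unique = Unique.applyUpTo⁺₁ _ K
      (λ r<r′ _ eq → <⇒≢ r<r′ (+-cancelʳ-≡ _ _ _ (suc-injective (entry-injective w s (cong (proj₁ ∘ proj₂) eq)))))

    instances-inverted : ∀ {τ} → τ ∈ instances →
      TripleInvertedBetween w s e τ × proj₂ (proj₂ τ) < proj₁ (proj₂ τ) × proj₁ (proj₂ τ) < proj₁ τ
    instances-inverted τ∈ with ∈-instances⁻ τ∈
    ... | z , p<z , z<q , refl = triple-inverted z p<z z<q , lo-min z p<z (<⇒≤ z<q) , hi-max z (<⇒≤ p<z) z<q

    instances-321 : ∀ {τ} → τ ∈ instances → Instance321 w n τ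
    instances-321 τ∈ with ∈-instances⁻ τ∈
    ... | z , p<z , z<q , refl with triple-inverted z p<z z<q
    ...   | (_ , inv-qz) , _ , (_ , inv-zp) =
      instance321 (f q) (f z) (f p) e e e≤L e≤L (hi-max z (<⇒≤ p<z) z<q) (lo-min z p<z (<⇒≤ z<q)) inv-qz inv-zp
        (proj₁ (f-bounded q (<⇒≤ p<q) ≤-refl)) (proj₂ (f-bounded q (<⇒≤ p<q) ≤-refl))
        (proj₁ (f-bounded p ≤-refl (<⇒≤ p<q))) (proj₂ (f-bounded p ≤-refl (<⇒≤ p<q)))

  windows-disjoint : ∀ j j′ → j ≢ j′ → (Window.e j ≤ Window.s j′ × Window.s j′ ≤ L) ⊎ (Window.e j′ ≤ Window.s j × Window.s j ≤ L)
  windows-disjoint j j′ j≢j′ with clusters-disjoint a₀ bs j j′ j≢j′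
  ... | inj₁ j-first  = inj₁ (subst (_≤ Window.s j′) (sym (Window.e≡ j)) j-first , Window.s≤L j′)
  ... | inj₂ j′-first = inj₂ (subst (_≤ Window.s j) (sym (Window.e≡ j′)) j′-first , Window.s≤L j)

  instances-disjoint : ∀ j j′ → j ≢ j′ → ∀ {τ} → τ ∈ Window.instances j → τ ∉ Window.instances j′
  instances-disjoint j j′ j≢j′ {a , b , c} τ∈ τ∈′ with Window.instances-inverted j τ∈ | Window.instances-inverted j′ τ∈′
  ... | (_ , inv , _) , c<b , b<a | (_ , inv′ , _) , _ , _ =
    inverted-in-one-window a c (Window.s j) (Window.e j) (Window.s j′) (Window.e j′) (<-trans c<b b<a) inv inv′ (windows-disjoint j j′ j≢j′)

  allInstances : List (ℕ × ℕ × ℕ)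
  allInstances = concat (tabulate Window.instances)

  ∈-allInstances⁻ : ∀ {τ} → τ ∈ allInstances → Σ (Fin (length bs)) λ j → τ ∈ Window.instances j
  ∈-allInstances⁻ τ∈ with ∈-concat⁻′ (tabulate Window.instances) τ∈
  ... | _ , τ∈T , T∈ with ∈-tabulate⁻ T∈
  ...   | j , refl = j , τ∈T

  allInstances-unique : Unique allInstances
  allInstances-unique = Unique.concat⁺ (All.tabulate⁺ Window.instances-unique)
    (AllPairs.tabulate⁺ (λ {j} {j′} j≢j′ (τ∈ , τ∈′) → instances-disjoint j j′ j≢j′ τ∈ τ∈′))

  length-allInstances : length allInstances ≡ sum (map num bs)
  length-allInstances = trans (length-concat (tabulate Window.instances)) (sum-length-tabulate bs Window.instances Window.length-instances)

  N321-exceeded : ∀ τ → Instance321 w n τ → τ ∉ allInstances → sum (map num bs) < N321 (perm n w)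
  N321-exceeded τ τ-321 τ∉ = subst₂ _≤_ (trans (length-++ allInstances) (trans (+-comm _ 1) (cong suc length-allInstances))) refl
    (instances≤N321 n w (allInstances ++ τ ∷ []) valid
      (Unique.++⁺ allInstances-unique ([] ∷ []) (λ { (τ∈ , here refl) → τ∉ τ∈ })) all-321)
    where
    all-321 : ∀ {v} → v ∈ allInstances ++ τ ∷ [] → Instance321 w n v
    all-321 v∈ with ∈-++⁻ allInstances v∈
    ... | inj₁ v∈all with ∈-allInstances⁻ v∈all
    ...   | j , v∈j = Window.instances-321 j v∈j
    all-321 v∈ | inj₂ (here refl) = τ-321

  -- An occurrence at t₀ outside the window of a letter in [p, q) yields a disturbance: walking from t₀
  -- towards the window, take the letter in [p, q) closest to the window.
  module StrayLetter (j : Fin (length bs)) (t₀ : ℕ) (t₀<L : t₀ < L) (in-range : Window.InRange j (letter w t₀)) where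
    open Window j

    undisturbed-step : ∀ t → ¬ InRange (letter w t) → ∀ z → p < z → z < q → entry w (suc t) z ≡ entry w t z
    undisturbed-step t out z p<z z<q = cong (entry w t) (swap-fixes-interior (letter w t) z out p<z z<q)

    first-after : ∀ d t → d + t ≡ t₀ → Undisturbed t →
                  Σ ℕ λ t* → t ≤ t* × t* ≤ t₀ × InRange (letter w t*) × Undisturbed t*
    first-after zero    t refl und = t , ≤-refl , ≤-refl , in-range , und
    first-after (suc d) t d+t≡t₀ und with inRange? (letter w t)
    ... | yes hit = t , ≤-refl , subst (t ≤_) d+t≡t₀ (m≤n+m t (suc d)) , hit , und
    ... | no out with first-after d (suc t) (trans (+-suc d t) d+t≡t₀)
                        (λ z p<z z<q → trans (undisturbed-step t out z p<z z<q) (und z p<z z<q))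
    ...   | t* , t<t* , rest = t* , <⇒≤ t<t* , rest

    last-before : ∀ d → Undisturbed (suc (d + t₀)) →
                  Σ ℕ λ t* → t₀ ≤ t* × t* ≤ d + t₀ × InRange (letter w t*) × Undisturbed (suc t*)
    last-before zero    und = t₀ , ≤-refl , ≤-refl , in-range , und
    last-before (suc d) und with inRange? (letter w (suc (d + t₀)))
    ... | yes hit = suc (d + t₀) , m≤n+m t₀ (suc d) , ≤-refl , hit , und
    ... | no out with last-before d (λ z p<z z<q → trans (sym (undisturbed-step (suc (d + t₀)) out z p<z z<q)) (und z p<z z<q))
    ...   | t* , t₀≤t* , t*≤ , rest = t* , t₀≤t* , m≤n⇒m≤1+n t*≤ , rest

    after-window : e ≤ t₀ → Disturbance
    after-window e≤t₀ with first-after (t₀ ∸ e) e (m∸n+n≡m e≤t₀)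
                             (λ z p<z z<q → trans (entry-e z) (cong f (transpose-other p q z (>⇒≢ p<z) (<⇒≢ z<q))))
    ... | t* , e≤t* , t*≤t₀ , (p≤x , x<q) , und = record
      { t* = t* ; t*<L = ≤-<-trans t*≤t₀ t₀<L ; apart = inj₁ (e≤t* , <⇒≤ (≤-<-trans t*≤t₀ t₀<L))
      ; z = proj₁ moved ; p<z = proj₁ (proj₂ moved) ; z<q = proj₁ (proj₂ (proj₂ moved)) ; moves = proj₂ (proj₂ (proj₂ moved)) }
      where
      x : ℕ
      x = letter w t*
      moved : Σ ℕ λ z → p < z × z < q × (f z ≡ entry w t* x ⊎ f z ≡ entry w t* (suc x))
      moved with m≤n⇒m<n∨m≡n p≤x
      ... | inj₁ p<x = x , p<x , x<q , inj₁ (sym (und x p<x x<q))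
      ... | inj₂ p≡x = suc p , n<1+n p , 1+p<q ,
                       inj₂ (sym (trans (cong (entry w t* ∘ suc) (sym p≡x)) (und (suc p) (n<1+n p) 1+p<q)))

    before-window : t₀ < s → Disturbance
    before-window t₀<s with last-before (s ∸ suc t₀) (λ z _ _ → cong (λ t → entry w t z) d+t₀≡s)
      where
      d+t₀≡s : suc (s ∸ suc t₀ + t₀) ≡ s
      d+t₀≡s = trans (sym (+-suc (s ∸ suc t₀) t₀)) (m∸n+n≡m t₀<s)
    ... | t* , _ , t*≤ , (p≤x , x<q) , und = record
      { t* = t* ; t*<L = <-≤-trans t*<s s≤L ; apart = inj₂ (t*<s , s≤L)
      ; z = proj₁ moved ; p<z = proj₁ (proj₂ moved) ; z<q = proj₁ (proj₂ (proj₂ moved)) ; moves = proj₂ (proj₂ (proj₂ moved)) }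
      where
      t*<s : t* < s
      t*<s = subst (t* <_) (trans (sym (+-suc (s ∸ suc t₀) t₀)) (m∸n+n≡m t₀<s)) (s≤s t*≤)
      x : ℕ
      x = letter w t*
      moved : Σ ℕ λ z → p < z × z < q × (f z ≡ entry w t* x ⊎ f z ≡ entry w t* (suc x))
      moved with m≤n⇒m<n∨m≡n p≤x
      ... | inj₁ p<x = x , p<x , x<q , inj₂ (trans (sym (und x p<x x<q)) (cong (entry w t*) (swap-left x)))
      ... | inj₂ p≡x = suc p , n<1+n p , 1+p<q , inj₁ (begin
        f (suc p)                        ≡⟨ und (suc p) (n<1+n p) 1+p<q ⟨
        entry w t* (swap x (suc p))      ≡⟨ cong (λ u → entry w t* (swap u (suc p))) (sym p≡x) ⟩
        entry w t* (swap p (suc p))      ≡⟨ cong (entry w t*) (swap-right p) ⟩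
        entry w t* p                     ≡⟨ cong (entry w t*) p≡x ⟩
        entry w t* x                     ∎)
        where open ≡-Reasoning

    disturbance : t₀ < s ⊎ e ≤ t₀ → Disturbance
    disturbance = [ before-window , after-window ]′

  -- At a disturbance the values A < B at positions x, x + 1 get inverted outside every window, and
  -- together with the cluster values f p < f z < f q they form a [321]-instance that no cluster accounts for.
  module ExtraInstance (j : Fin (length bs)) (D : Window.Disturbance j) where
    open Window j
    open Disturbance D

    x A B : ℕ
    x = letter w t*
    A = entry w t* x
    B = entry w t* (suc x)

    A<B : A < B
    A<B = asc t* t*<L

    swapped : InvertedBetween w B A t* (suc t*)
    swapped = subst₂ _<_ (sym (place-entry w t* x)) (sym (place-entry w t* (suc x))) (n<1+n x) ,
              subst₂ _<_ (sym (trans (cong (swap x) (place-entry w t* (suc x))) (swap-right x)))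
                         (sym (trans (cong (swap x) (place-entry w t* x)) (swap-left x))) (n<1+n x)

    not-also-in-window : ∀ a b → b < a → InvertedBetween w a b s e → ¬ InvertedBetween w a b t* (suc t*)
    not-also-in-window a b b<a inv inv* = inverted-in-one-window a b s e t* (suc t*) b<a inv inv* apart

    x-valid : 1 ≤ x × suc x ≤ n
    x-valid = letter-valid w t* valid t*<L

    A-bounded : 1 ≤ A × A ≤ n
    A-bounded = entry-bounded w valid t* (<⇒≤ t*<L) x (proj₁ x-valid) (≤-trans (n≤1+n x) (proj₂ x-valid))

    B-bounded : 1 ≤ B × B ≤ n
    B-bounded = entry-bounded w valid t* (<⇒≤ t*<L) (suc x) (s≤s z≤n) (proj₂ x-valid)

    fp-bounded : 1 ≤ f p × f p ≤ n
    fp-bounded = f-bounded p ≤-refl (<⇒≤ p<q)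

    fq-bounded : 1 ≤ f q × f q ≤ n
    fq-bounded = f-bounded q (<⇒≤ p<q) ≤-refl

    inv-z : TripleInvertedBetween w s e (triple z)
    inv-z = triple-inverted z p<z z<q

    Extra : Set
    Extra = Σ (ℕ × ℕ × ℕ) λ τ → Instance321 w n τ × τ ∉ allInstances

    extra-when-lower : f z ≡ A → Extra
    extra-when-lower fz≡A = (B , f z , f p) ,
      instance321 B (f z) (f p) (suc t*) e t*<L e≤L fz<B (lo-min z p<z (<⇒≤ z<q))
        (subst (λ u → place w (suc t*) B < place w (suc t*) u) (sym fz≡A) (proj₂ swapped))
        (proj₂ (proj₂ (proj₂ inv-z))) (proj₁ B-bounded) (proj₂ B-bounded) (proj₁ fp-bounded) (proj₂ fp-bounded) ,
      not-listed
      where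
      fz<B : f z < B
      fz<B = subst (_< B) (sym fz≡A) A<B
      not-listed : (B , f z , f p) ∉ allInstances
      not-listed τ∈ with ∈-allInstances⁻ τ∈
      ... | j′ , τ∈′ with Window.instances-inverted j′ τ∈′ | j′ Fin.≟ j
      ...   | (inv , _ , _) , _ | yes refl =
        not-also-in-window B (f z) fz<B inv (subst (λ u → InvertedBetween w B u t* (suc t*)) (sym fz≡A) swapped)
      ...   | (_ , _ , inv) , _ | no j′≢j =
        inverted-in-one-window (f z) (f p) s e (Window.s j′) (Window.e j′) (lo-min z p<z (<⇒≤ z<q))
          (proj₂ (proj₂ inv-z)) inv (windows-disjoint j j′ (≢-sym j′≢j))

    extra-when-upper : f z ≡ B → Extra
    extra-when-upper fz≡B = (f q , f z , A) ,
      instance321 (f q) (f z) A e (suc t*) e≤L t*<L (hi-max z (<⇒≤ p<z) z<q) A<fz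
        (proj₂ (proj₁ inv-z)) (subst (λ u → place w (suc t*) u < place w (suc t*) A) (sym fz≡B) (proj₂ swapped))
        (proj₁ fq-bounded) (proj₂ fq-bounded) (proj₁ A-bounded) (proj₂ A-bounded) ,
      not-listed
      where
      A<fz : A < f z
      A<fz = subst (A <_) (sym fz≡B) A<B
      not-listed : (f q , f z , A) ∉ allInstances
      not-listed τ∈ with ∈-allInstances⁻ τ∈
      ... | j′ , τ∈′ with Window.instances-inverted j′ τ∈′ | j′ Fin.≟ j
      ...   | (_ , _ , inv) , _ | yes refl =
        not-also-in-window (f z) A A<fz inv (subst (λ u → InvertedBetween w u A t* (suc t*)) (sym fz≡B) swapped)
      ...   | (inv , _ , _) , _ | no j′≢j =
        inverted-in-one-window (f q) (f z) s e (Window.s j′) (Window.e j′) (hi-max z (<⇒≤ p<z) z<q)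
          (proj₁ inv-z) inv (windows-disjoint j j′ (≢-sym j′≢j))

    extra : Extra
    extra with moves
    ... | inj₁ fz≡A = extra-when-lower fz≡A
    ... | inj₂ fz≡B = extra-when-upper fz≡B

  stray-letter : sum (map num bs) ≡ N321 (perm n w) → ∀ j t₀ → t₀ < L → Window.InRange j (letter w t₀) →
                 ¬ (t₀ < Window.s j ⊎ Window.e j ≤ t₀)
  stray-letter N≡ j t₀ t₀<L in-range outside
    with ExtraInstance.extra j (StrayLetter.disturbance j t₀ t₀<L in-range outside)
  ... | τ , τ-321 , τ∉ = <-irrefl N≡ (N321-exceeded τ τ-321 τ∉)

  letter-outside-window : sum (map num bs) ≡ N321 (perm n w) → ∀ j i → i ∈ cl (lookup bs j) → ∀ u t → FactorAt w t u →
    (t + length u ≤ clusterStart a₀ bs j) ⊎ (clusterStart a₀ bs j + length (cl (lookup bs j)) ≤ t) → i ∉ u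
  letter-outside-window N≡ j i i∈c u t u-at-t apart i∈u with FactorAt-∈ w t u i u-at-t i∈u
  ... | r , r< , refl = stray-letter N≡ j (t + r) (<-≤-trans (+-monoʳ-< t r<) (proj₁ u-at-t)) in-range outside
    where
    open Window j
    in-range : InRange (letter w (t + r))
    in-range = let (p≤ , ≤top) = letters-bounded _ (subst (letter w (t + r) ∈_) cl≡clusterWord i∈c) in p≤ , s≤s ≤top
    outside : t + r < s ⊎ e ≤ t + r
    outside = Sum.map (<-≤-trans (+-monoʳ-< t r<)) (λ e≤t → ≤-trans (≤-reflexive e≡) (≤-trans e≤t (m≤m+n t r))) apart

lemma2p3 : (n : ℕ) (a0 : List ℕ) (bs : List Block) → ContractedSBA n a0 bs →
    (j : Fin (length bs)) (i : ℕ) → i ∈ cl (lookup bs j) →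
      (i ∉ a0) ×
      ((k : Fin (length bs)) → (i ∉ aft (lookup bs k)) × (k ≢ j → i ∉ cl (lookup bs k)))
lemma2p3 n a0 bs (valid , reduced , clusters , N≡ , _ , _) j i i∈c =
  outside a0 0 (a₀-factor a0 bs) (inj₁ (a₀≤clusterStart a0 bs j)) ,
  λ k → outside (aft (lookup bs k)) _ (after-factor a0 bs k) (cluster-after-disjoint a0 bs j k) ,
        λ k≢j → outside (cl (lookup bs k)) _ (cluster-factor a0 bs k) (Sum.swap (clusters-disjoint a0 bs j k (≢-sym k≢j)))
  where
  open Contracted n a0 bs valid (reduced⇒ascending n _ valid reduced) clusters
  outside : ∀ u t → FactorAt w t u →
    (t + length u ≤ clusterStart a0 bs j) ⊎ (clusterStart a0 bs j + length (cl (lookup bs j)) ≤ t) → i ∉ u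
  outside = letter-outside-window N≡ j i i∈c
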